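{- Let $Q(n_1,n_2,n_3)=\frac{n_1^2}{2}+3n_2^2+\frac{9n_3^2}{2}+2n_1n_2+6n_2n_3+3n_1n_3$ and define $$F_1(x)=\cdots=F_6(x)=\sum_{n_1,n_2,n_3\ge 0}\frac{q^{Q(n_1,n_2,n_3)+\frac{n_1}{2}-n_2-\frac{n_3}{2}}x^{n_1+2n_2+3n_3}}{(q;q)_{n_1}(q^2;q^2)_{n_2}(q^3;q^3)_{n_3}},$$ $$F_7(x)=\cdots=F_{13}(x)=\sum_{n_1,n_2,n_3\ge 0}\frac{q^{Q(n_1,n_2,n_3)+\frac{3n_1}{2}+n_2+\frac{5n_3}{2}}x^{n_1+2n_2+3n_3}}{(q;q)_{n_1}(q^2;q^2)_{n_2}(q^3;q^3)_{n_3}},$$ $$F_{14}(x)=\cdots=F_{21}(x)=\sum_{n_1,n_2,n_3\ge 0}\frac{q^{Q(n_1,n_2,n_3)+\frac{3n_1}{2}+3n_2+\frac{11n_3}{2}}x^{n_1+2n_2+3n_3}}{(q;q)_{n_1}(q^2;q^2)_{n_2}(q^3;q^3)_{n_3}},$$ $$F_{22}(x)=F_{23}(x)=\sum_{n_1,n_2,n_3\ge 0}\frac{q^{Q(n_1,n_2,n_3)+\frac{5n_1}{2}+3n_2+\frac{11n_3}{2}}x^{n_1+2n_2+3n_3}}{(q;q)_{n_1}(q^2;q^2)_{n_2}(q^3;q^3)_{n_3}}.$$ Let $\mathscr{A}$ be the $23\times 23$ $(0,1)$-matrix whose $i$-th row has entry $1$ exactly in the columns listed below and $0$ elsewhere: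 rows $1$–$6$: all columns $1,\ldots,23$; rows $7$–$13$: columns $\{1,2,7,8,9,10,14,15,16,17,22\}$; rows $14$–$21$: columns $\{1,2,7,8,14,15,16,22\}$; rows $22$–$23$: columns $\{1,7,14,15,22\}$. Let $$\mathscr{W}(x)=\operatorname{diag}\big(1,xq^2,xq,x^2q^3,x^2q^2,x^3q^4,\ xq^3,x^2q^5,x^2q^4,x^3q^7,x^2q^4,x^3q^6,x^3q^5,\ x^2q^7,x^2q^6,x^3q^9,x^3q^8,x^3q^8,x^3q^7,x^4q^{10},x^4q^9,\ x^3q^{10},x^4q^{11}\big).$$ Then $$\begin{pmatrix}F_1(x)\\ \vdots\\ F_{23}(x)\end{pmatrix}=\mathscr{A}\,\mathscr{W}(x)\begin{pmatrix}F_1(xq^3)\\ \vdots\\ F_{23}(xq^3)\end{pmatrix}.$$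
   Context: $(a;q)_n=\prod_{j=0}^{n-1}(1-aq^j)$. The exponents of $q$ in the summands are non-negative integers for all $n_1,n_2,n_3\ge 0$. The identity is between formal power series in $x$ and $q$ (equivalently, analytic functions for $|q|<1$). -}

module Defs where

open import Data.Nat as ℕ using (ℕ; zero; suc; _∸_)
open import Data.Nat.Divisibility using (_∣?_)
open import Data.Integer as ℤ using (ℤ; +_; -[1+_])
open import Data.Fin using (Fin; toℕ)
open import Data.Vec using (Vec; []; _∷_; lookup)
open import Data.List using (List; []; _∷_)
open import Data.Bool using (Bool; true; false; if_then_else_; _∧_; _∨_)
open import Data.Product using (_×_; _,_; proj₁; proj₂)
open import Relation.Nullary.Decidable using (⌊_⌋)

-- Formal power series in two variables x, q with integer coefficients.
-- f m k  is the coefficient of  x^m q^k.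

Series : Set
Series = ℕ → ℕ → ℤ

sumTo : ℕ → (ℕ → ℤ) → ℤ
sumTo zero    h = h 0
sumTo (suc n) h = sumTo n h ℤ.+ h (suc n)

_⊛_ : Series → Series → Series
(f ⊛ g) m k = sumTo m λ i → sumTo k λ j → f i j ℤ.* g (m ∸ i) (k ∸ j)

infixl 7 _⊛_

oneS : Series
oneS m k = if ⌊ m ℕ.≟ 0 ⌋ ∧ ⌊ k ℕ.≟ 0 ⌋ then + 1 else + 0

-- the monomial x^a q^(d/2), given the doubled exponent d ∈ ℤ of q
-- (coefficient 1 at x^m q^k iff m = a and 2k = d)
monoHalf : ℕ → ℤ → Series
monoHalf a d m k = if ⌊ m ℕ.≟ a ⌋ ∧ ⌊ + (2 ℕ.* k) ℤ.≟ d ⌋ then + 1 else + 0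

mono : ℕ → ℕ → Series
mono a b m k = if ⌊ m ℕ.≟ a ⌋ ∧ ⌊ k ℕ.≟ b ⌋ then + 1 else + 0

-- 1/(1 - q^d) = Σ_{t ≥ 0} q^{d t}  (used for d ≥ 1)
geomInv : ℕ → Series
geomInv d m k = if ⌊ m ℕ.≟ 0 ⌋ ∧ ⌊ d ∣? k ⌋ then + 1 else + 0

-- 1/(q^a;q^a)_n = Π_{j=1}^{n} 1/(1 - q^{a j})
pochInv : ℕ → ℕ → Series
pochInv a zero    = oneS
pochInv a (suc n) = pochInv a n ⊛ geomInv (a ℕ.* suc n)

-- substitution x ↦ x q^3 :  [x^m q^k] f(x q^3) = [x^m q^(k-3m)] f(x)
substXq3 : Series → Series
substXq3 f m k = if ⌊ 3 ℕ.* m ℕ.≤? k ⌋ then f m (k ∸ 3 ℕ.* m) else + 0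

-- The series  Σ_{n1,n2,n3≥0} q^{Q(n)+L(n)} x^{n1+2n2+3n3} / ((q;q)_{n1}(q^2;q^2)_{n2}(q^3;q^3)_{n3})
-- where the linear part L is given by its doubled coefficients (l1,l2,l3):
-- L(n) = (l1 n1 + l2 n2 + l3 n3)/2.

twoQ : ℕ → ℕ → ℕ → ℤ
twoQ n1 n2 n3 = + (n1 ℕ.* n1 ℕ.+ 6 ℕ.* (n2 ℕ.* n2) ℕ.+ 9 ℕ.* (n3 ℕ.* n3)
                  ℕ.+ 4 ℕ.* (n1 ℕ.* n2) ℕ.+ 12 ℕ.* (n2 ℕ.* n3) ℕ.+ 6 ℕ.* (n1 ℕ.* n3))

summand : ℤ → ℤ → ℤ → ℕ → ℕ → ℕ → Series
summand l1 l2 l3 n1 n2 n3 =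
  monoHalf (n1 ℕ.+ 2 ℕ.* n2 ℕ.+ 3 ℕ.* n3)
           (twoQ n1 n2 n3 ℤ.+ l1 ℤ.* + n1 ℤ.+ l2 ℤ.* + n2 ℤ.+ l3 ℤ.* + n3)
  ⊛ pochInv 1 n1 ⊛ pochInv 2 n2 ⊛ pochInv 3 n3

-- The infinite sum over n1,n2,n3 ≥ 0, taken coefficientwise: the summand
-- indexed by (n1,n2,n3) has x-degree exactly n1+2n2+3n3, so only triples with
-- all n_i ≤ m contribute to the coefficient of x^m.
tripleSum : ℤ → ℤ → ℤ → Series
tripleSum l1 l2 l3 m k =
  sumTo m λ n1 → sumTo m λ n2 → sumTo m λ n3 → summand l1 l2 l3 n1 n2 n3 m k

-- block of an index i (0-based): rows/series 1–6, 7–13, 14–21, 22–23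
data Block : Set where
  b1 b2 b3 b4 : Block

block : Fin 23 → Block
block i = if ⌊ toℕ i ℕ.<? 6 ⌋ then b1 else
          if ⌊ toℕ i ℕ.<? 13 ⌋ then b2 else
          if ⌊ toℕ i ℕ.<? 21 ⌋ then b3 else b4

blockSeries : Block → Series
blockSeries b1 = tripleSum (+ 1) (ℤ.- + 2) (ℤ.- + 1)
blockSeries b2 = tripleSum (+ 3) (+ 2) (+ 5)
blockSeries b3 = tripleSum (+ 3) (+ 6) (+ 11)
blockSeries b4 = tripleSum (+ 5) (+ 6) (+ 11)

-- F_1, …, F_23 (index i : Fin 23 stands for F_{i+1})
F : Fin 23 → Series
F i = blockSeries (block i)

-- The matrix 𝒜 (columns listed 1-based, as in the paper)

elemℕ : ℕ → List ℕ → Bool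
elemℕ n []       = false
elemℕ n (x ∷ xs) = ⌊ n ℕ.≟ x ⌋ ∨ elemℕ n xs

columns : Block → List ℕ
columns b1 = 1 ∷ 2 ∷ 3 ∷ 4 ∷ 5 ∷ 6 ∷ 7 ∷ 8 ∷ 9 ∷ 10 ∷ 11 ∷ 12 ∷ 13 ∷ 14 ∷ 15 ∷ 16
           ∷ 17 ∷ 18 ∷ 19 ∷ 20 ∷ 21 ∷ 22 ∷ 23 ∷ []
columns b2 = 1 ∷ 2 ∷ 7 ∷ 8 ∷ 9 ∷ 10 ∷ 14 ∷ 15 ∷ 16 ∷ 17 ∷ 22 ∷ []
columns b3 = 1 ∷ 2 ∷ 7 ∷ 8 ∷ 14 ∷ 15 ∷ 16 ∷ 22 ∷ []
columns b4 = 1 ∷ 7 ∷ 14 ∷ 15 ∷ 22 ∷ []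

𝒜 : Fin 23 → Fin 23 → ℤ
𝒜 i j = if elemℕ (suc (toℕ j)) (columns (block i)) then + 1 else + 0

-- diagonal of 𝒲(x): entry j is x^a q^b with (a , b) listed below
wExps : Vec (ℕ × ℕ) 23
wExps = (0 , 0) ∷ (1 , 2) ∷ (1 , 1) ∷ (2 , 3) ∷ (2 , 2) ∷ (3 , 4)
      ∷ (1 , 3) ∷ (2 , 5) ∷ (2 , 4) ∷ (3 , 7) ∷ (2 , 4) ∷ (3 , 6) ∷ (3 , 5)
      ∷ (2 , 7) ∷ (2 , 6) ∷ (3 , 9) ∷ (3 , 8) ∷ (3 , 8) ∷ (3 , 7) ∷ (4 , 10) ∷ (4 , 9)
      ∷ (3 , 10) ∷ (4 , 11) ∷ []

𝒲 : Fin 23 → Series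
𝒲 j = mono (proj₁ (lookup wExps j)) (proj₂ (lookup wExps j))

_·_ : ℤ → Series → Series
(c · f) m k = c ℤ.* f m k

sumFin : (n : ℕ) → (Fin n → Series) → Series
sumFin zero    h m k = + 0
sumFin (suc n) h m k = h Fin.zero m k ℤ.+ sumFin n (λ j → h (Fin.suc j)) m k
  where import Data.Fin as Fin

rhs : Fin 23 → Series
rhs i = sumFin 23 λ j → 𝒜 i j · (𝒲 j ⊛ substXq3 (F j))

module Submission where

-- All four series are members of one family, indexed by p = (α, β, γ) ∈ ℕ³,
--   W(p) = Σ_{n₁,n₂,n₃ ≥ 0} x^N q^{T(N) + n₂² + α n₁ + β n₂ + γ n₃}
--                           / ((q;q)_{n₁} (q²;q²)_{n₂} (q³;q³)_{n₃}),
-- where N = n₁ + 2n₂ + 3n₃ and T(N) = N(N-1)/2; since 2Q(n) = N² + 2n₂², the blocks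
-- are F = W(1,0,1), W(2,2,4), W(2,4,7), W(3,4,7).  The family satisfies
--   (R₁)  W(α,β,γ) = W(α+1,β,γ)   + x  q^α     W(α+1,β+2,γ+3),
--   (R₂)  W(α,β,γ) = W(α,β+2,γ)   + x² q^{β+2} W(α+2,β+6,γ+6),
--   (R₃)  W(α,β,γ) = W(α,β,γ+3)   + x³ q^{γ+3} W(α+3,β+6,γ+9),
-- each coming from 1/(q^a;q^a)_n = 1/(q^a;q^a)_{n-1} + q^{an}/(q^a;q^a)_n, together with
--   (S)   W(α,β,γ)(xq³) = W(α+3,β+6,γ+9)(x).
-- Applying (R₁)-(R₃) along a suitable expansion tree rewrites every block as a sum of
-- monomials times W(4,6,10), W(5,8,13), W(5,10,16), W(6,10,16), i.e. by (S) times the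
-- F_j(xq³); a decidable multiset comparison matches these terms with the nonzero entries of
-- row i of 𝒜𝒲(x).

open import Defs
open import Data.Nat using (ℕ)
open import Data.Fin using (Fin)
open import Relation.Binary.PropositionalEquality using (_≡_)

open import Data.Nat as ℕ using (zero; suc; _+_; _*_; _∸_; _≤_; _<_; z≤n; s≤s; s≤s⁻¹)
import Data.Nat.Divisibility as ÷
import Data.Nat.Properties as ℕP
open import Data.Integer as ℤ using (ℤ; +_) renaming (_+_ to _+ℤ_; _*_ to _*ℤ_)
import Data.Integer.Properties as ℤP
open import Algebra.Properties.CommutativeSemigroup ℤP.+-commutativeSemigroup
  using (interchange; x∙yz≈xz∙y; xy∙z≈xz∙y; x∙yz≈y∙xz)
open import Data.Bool using (Bool; true; false; if_then_else_; _∧_)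
open import Data.Bool.Properties using (∧-zeroʳ)
open import Data.Product using (_×_; _,_; proj₁; proj₂)
open import Data.Product.Properties using (≡-dec)
open import Data.List using (List; []; _∷_; _++_; map)
open import Data.Maybe using (Maybe; just; nothing)
import Data.Maybe as Maybe
open import Data.Fin using (toℕ) renaming (zero to fzero; suc to fsuc)
open import Data.Vec using (lookup)
open import Relation.Binary.Definitions using (DecidableEquality)
open import Function.Bundles using (_⇔_; mk⇔)
open import Relation.Binary.Bundles using (Setoid)
import Relation.Binary.Reasoning.Setoid as SetoidReasoning
open import Relation.Binary.PropositionalEquality
  using (refl; sym; trans; cong; cong₂; module ≡-Reasoning)
open import Relation.Nullary using (¬_; contradiction)
open import Relation.Nullary.Decidable using (Dec; yes; no; ⌊_⌋; isYes≗does; does-⇔)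

sumTo-cong : ∀ n {f g : ℕ → ℤ} → (∀ i → i ≤ n → f i ≡ g i) → sumTo n f ≡ sumTo n g
sumTo-cong zero    f≗g = f≗g 0 z≤n
sumTo-cong (suc n) f≗g =
  cong₂ _+ℤ_ (sumTo-cong n λ i i≤n → f≗g i (ℕP.m≤n⇒m≤1+n i≤n)) (f≗g (suc n) ℕP.≤-refl)

sumTo-zero : ∀ n {f : ℕ → ℤ} → (∀ i → i ≤ n → f i ≡ + 0) → sumTo n f ≡ + 0
sumTo-zero zero    f≗0 = f≗0 0 z≤n
sumTo-zero (suc n) f≗0 =
  cong₂ _+ℤ_ (sumTo-zero n λ i i≤n → f≗0 i (ℕP.m≤n⇒m≤1+n i≤n)) (f≗0 (suc n) ℕP.≤-refl)

sumTo-+ : ∀ n (f g : ℕ → ℤ) → sumTo n (λ i → f i +ℤ g i) ≡ sumTo n f +ℤ sumTo n g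
sumTo-+ zero    f g = refl
sumTo-+ (suc n) f g = trans (cong (_+ℤ (f (suc n) +ℤ g (suc n))) (sumTo-+ n f g))
                            (interchange (sumTo n f) (sumTo n g) (f (suc n)) (g (suc n)))

sumTo-front : ∀ n (f : ℕ → ℤ) → sumTo (suc n) f ≡ f 0 +ℤ sumTo n (λ i → f (suc i))
sumTo-front zero    f = refl
sumTo-front (suc n) f =
  trans (cong (_+ℤ f (suc (suc n))) (sumTo-front n f)) (ℤP.+-assoc (f 0) _ _)

sumTo-head : ∀ n (f : ℕ → ℤ) → (∀ i → f (suc i) ≡ + 0) → sumTo n f ≡ f 0
sumTo-head zero    f _   = refl
sumTo-head (suc n) f f≗0 =
  trans (cong (sumTo n f +ℤ_) (f≗0 n)) (trans (ℤP.+-identityʳ _) (sumTo-head n f f≗0))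

sumTo-reverse : ∀ n (h : ℕ → ℕ → ℤ) → sumTo n (λ i → h i (n ∸ i)) ≡ sumTo n (λ i → h (n ∸ i) i)
sumTo-reverse zero    h = refl
sumTo-reverse (suc n) h = begin
  sumTo n (λ i → h i (suc n ∸ i)) +ℤ h (suc n) (n ∸ n)
    ≡⟨ cong₂ _+ℤ_ (sumTo-cong n λ i i≤n → cong (h i) (ℕP.+-∸-assoc 1 i≤n))
                  (cong (h (suc n)) (ℕP.n∸n≡0 n)) ⟩
  sumTo n (λ i → h i (suc (n ∸ i))) +ℤ h (suc n) 0
    ≡⟨ cong (_+ℤ h (suc n) 0) (sumTo-reverse n λ i j → h i (suc j)) ⟩
  sumTo n (λ i → h (n ∸ i) (suc i)) +ℤ h (suc n) 0
    ≡⟨ ℤP.+-comm _ (h (suc n) 0) ⟩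
  h (suc n) 0 +ℤ sumTo n (λ i → h (n ∸ i) (suc i))
    ≡⟨ sym (sumTo-front n _) ⟩
  sumTo (suc n) (λ i → h (suc n ∸ i) i) ∎
  where open ≡-Reasoning

sumTo-telescope : ∀ n (x y z : ℕ → ℤ) → x 0 ≡ y 0 → (∀ i → x (suc i) ≡ y (suc i) +ℤ z i) →
                  sumTo n x +ℤ z n ≡ sumTo n y +ℤ sumTo n z
sumTo-telescope zero    x y z x₀ xₛ = cong (_+ℤ z 0) x₀
sumTo-telescope (suc n) x y z x₀ xₛ = begin
  (sumTo n x +ℤ x (suc n)) +ℤ z (suc n)
    ≡⟨ cong (λ t → (sumTo n x +ℤ t) +ℤ z (suc n)) (xₛ n) ⟩
  (sumTo n x +ℤ (y (suc n) +ℤ z n)) +ℤ z (suc n)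
    ≡⟨ cong (_+ℤ z (suc n)) (x∙yz≈xz∙y (sumTo n x) (y (suc n)) (z n)) ⟩
  ((sumTo n x +ℤ z n) +ℤ y (suc n)) +ℤ z (suc n)
    ≡⟨ cong (λ t → (t +ℤ y (suc n)) +ℤ z (suc n)) (sumTo-telescope n x y z x₀ xₛ) ⟩
  ((sumTo n y +ℤ sumTo n z) +ℤ y (suc n)) +ℤ z (suc n)
    ≡⟨ cong (_+ℤ z (suc n)) (xy∙z≈xz∙y (sumTo n y) (sumTo n z) (y (suc n))) ⟩
  ((sumTo n y +ℤ y (suc n)) +ℤ sumTo n z) +ℤ z (suc n)
    ≡⟨ ℤP.+-assoc (sumTo n y +ℤ y (suc n)) _ _ ⟩
  (sumTo n y +ℤ y (suc n)) +ℤ (sumTo n z +ℤ z (suc n)) ∎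
  where open ≡-Reasoning

sumTo-extend : ∀ {n n'} (f : ℕ → ℤ) → n ≤ n' → (∀ i → n < i → f i ≡ + 0) →
               sumTo n' f ≡ sumTo n f
sumTo-extend {n} f n≤n' f≗0 with ℕP.m≤n⇒∃[o]m+o≡n n≤n'
... | d , refl = extend d
  where
  extend : ∀ d → sumTo (n + d) f ≡ sumTo n f
  extend zero    = cong (λ t → sumTo t f) (ℕP.+-identityʳ n)
  extend (suc d) = begin
    sumTo (n + suc d) f             ≡⟨ cong (λ t → sumTo t f) (ℕP.+-suc n d) ⟩
    sumTo (n + d) f +ℤ f (suc (n + d)) ≡⟨ cong (sumTo (n + d) f +ℤ_) (f≗0 _ (s≤s (ℕP.m≤m+n n d))) ⟩
    sumTo (n + d) f +ℤ + 0          ≡⟨ ℤP.+-identityʳ _ ⟩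
    sumTo (n + d) f                 ≡⟨ extend d ⟩
    sumTo n f                       ∎
    where open ≡-Reasoning

-- Shifted sequences: lift a g is g multiplied by t^a

lift : ℕ → (ℕ → ℤ) → ℕ → ℤ
lift zero    g n       = g n
lift (suc a) g zero    = + 0
lift (suc a) g (suc n) = lift a g n

lift-at : ∀ a (g : ℕ → ℤ) n → lift a g (a + n) ≡ g n
lift-at zero    g n = refl
lift-at (suc a) g n = lift-at a g n

lift-below : ∀ a (g : ℕ → ℤ) {n} → n < a → lift a g n ≡ + 0
lift-below (suc a) g {zero}  _         = refl
lift-below (suc a) g {suc n} (s≤s n<a) = lift-below a g n<a

lift-zero : ∀ a n → lift a (λ _ → + 0) n ≡ + 0
lift-zero zero    n       = refl
lift-zero (suc a) zero    = refl
lift-zero (suc a) (suc n) = lift-zero a n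

lift-cong≤ : ∀ a {g h : ℕ → ℤ} n → (∀ i → i ≤ n → g i ≡ h i) → lift a g n ≡ lift a h n
lift-cong≤ zero    n       g≗h = g≗h n ℕP.≤-refl
lift-cong≤ (suc a) zero    g≗h = refl
lift-cong≤ (suc a) (suc n) g≗h = lift-cong≤ a n λ i i≤n → g≗h i (ℕP.m≤n⇒m≤1+n i≤n)

lift-cong : ∀ a {g h : ℕ → ℤ} → (∀ i → g i ≡ h i) → ∀ n → lift a g n ≡ lift a h n
lift-cong a g≗h n = lift-cong≤ a n λ i _ → g≗h i

lift-+ : ∀ a (g h : ℕ → ℤ) n → lift a (λ i → g i +ℤ h i) n ≡ lift a g n +ℤ lift a h n
lift-+ zero    g h n       = refl
lift-+ (suc a) g h zero    = refl
lift-+ (suc a) g h (suc n) = lift-+ a g h n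

lift-lift : ∀ a b (g : ℕ → ℤ) n → lift a (lift b g) n ≡ lift (a + b) g n
lift-lift zero    b g n       = refl
lift-lift (suc a) b g zero    = refl
lift-lift (suc a) b g (suc n) = lift-lift a b g n

lift-swap : ∀ a c (H : ℕ → ℕ → ℤ) i k →
            lift c (λ j → lift a (λ i' → H i' j) i) k ≡ lift a (λ i' → lift c (H i') k) i
lift-swap zero    c H i       k = refl
lift-swap (suc a) c H zero    k = lift-zero c k
lift-swap (suc a) c H (suc i) k = lift-swap a c H i k

infix  4 _≈_ _≈[_]_
infixl 6 _⊕_

_≈_ : Series → Series → Set
f ≈ g = ∀ m k → f m k ≡ g m k

_≈[_]_ : Series → ℕ → Series → Set
f ≈[ D ] g = ∀ m k → m ≤ D → f m k ≡ g m k

≈-sym : ∀ {f g} → f ≈ g → g ≈ f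
≈-sym f≈g m k = sym (f≈g m k)

≈-trans : ∀ {f g h} → f ≈ g → g ≈ h → f ≈ h
≈-trans f≈g g≈h m k = trans (f≈g m k) (g≈h m k)

≈⇒≈[] : ∀ {f g D} → f ≈ g → f ≈[ D ] g
≈⇒≈[] f≈g m k _ = f≈g m k

≈-setoid : Setoid _ _
≈-setoid = record
  { Carrier       = Series
  ; _≈_           = _≈_
  ; isEquivalence = record { refl = λ _ _ → refl ; sym = ≈-sym ; trans = ≈-trans }
  }

module ≈-Reasoning = SetoidReasoning ≈-setoid

𝟘 : Series
𝟘 m k = + 0

_⊕_ : Series → Series → Series
(f ⊕ g) m k = f m k +ℤ g m k

⊕-cong : ∀ {f f' g g'} → f ≈ f' → g ≈ g' → f ⊕ g ≈ f' ⊕ g'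
⊕-cong f≈f' g≈g' m k = cong₂ _+ℤ_ (f≈f' m k) (g≈g' m k)

-- multiplication by the monomial x^a q^c
shift : ℕ → ℕ → Series → Series
shift a c f m k = lift a (λ i → lift c (f i) k) m

shift-cong≤ : ∀ a c {f g D} → f ≈[ D ] g → shift a c f ≈[ D ] shift a c g
shift-cong≤ a c f≈g m k m≤D =
  lift-cong≤ a m λ i i≤m → lift-cong c (λ j → f≈g i j (ℕP.≤-trans i≤m m≤D)) k

shift-cong : ∀ a c {f g} → f ≈ g → shift a c f ≈ shift a c g
shift-cong a c f≈g m k = shift-cong≤ a c (≈⇒≈[] f≈g) m k ℕP.≤-refl

shift-⊕ : ∀ a c f g → shift a c (f ⊕ g) ≈ shift a c f ⊕ shift a c g
shift-⊕ a c f g m k =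
  trans (lift-cong a (λ i → lift-+ c (f i) (g i) k) m)
        (lift-+ a (λ i → lift c (f i) k) (λ i → lift c (g i) k) m)

shift-𝟘 : ∀ a c → shift a c 𝟘 ≈ 𝟘
shift-𝟘 a c m k = trans (lift-cong a (λ _ → lift-zero c k) m) (lift-zero a m)

shift-shift : ∀ a c a' c' f → shift a c (shift a' c' f) ≈ shift (a + a') (c + c') f
shift-shift a c a' c' f m k = begin
  lift a (λ i → lift c (λ j → lift a' (λ i' → lift c' (f i') j) i) k) m
    ≡⟨ lift-cong a (λ i → lift-swap a' c (λ i' → lift c' (f i')) i k) m ⟩
  lift a (lift a' (λ i' → lift c (lift c' (f i')) k)) m
    ≡⟨ lift-cong a (lift-cong a' (λ i' → lift-lift c c' (f i') k)) m ⟩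
  lift a (lift a' (λ i' → lift (c + c') (f i') k)) m
    ≡⟨ lift-lift a a' _ m ⟩
  shift (a + a') (c + c') f m k ∎
  where open ≡-Reasoning

-- the q-only special case, without the spurious x-exponent a + 0
shift-q : ∀ a c d f → shift a c (shift 0 d f) ≈ shift a (c + d) f
shift-q a c d f m k = lift-cong a (λ i → lift-lift c d (f i) k) m

XOrder : ℕ → Series → Set
XOrder D f = ∀ m k → m < D → f m k ≡ + 0

XOrder-weaken : ∀ {D D' f} → D' ≤ D → XOrder D f → XOrder D' f
XOrder-weaken D'≤D ord m k m<D' = ord m k (ℕP.<-≤-trans m<D' D'≤D)

XOrder-shift : ∀ a c {D f} → XOrder D f → XOrder (a + D) (shift a c f)
XOrder-shift a c {D} {f} ord m k m<a+D with a ℕ.≤? m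
... | no m≱a = lift-below a _ (ℕP.≰⇒> m≱a)
... | yes a≤m with ℕP.m≤n⇒∃[o]m+o≡n a≤m
...   | r , refl =
  trans (lift-at a _ r)
        (trans (lift-cong c (λ j → ord r j (ℕP.+-cancelˡ-< a r D m<a+D)) k) (lift-zero c k))

XOrder⇒≈𝟘 : ∀ {D f} → XOrder (suc D) f → f ≈[ D ] 𝟘
XOrder⇒≈𝟘 ord m k m≤D = ord m k (s≤s m≤D)

⊛-congˡ : ∀ {f f'} g → f ≈ f' → f ⊛ g ≈ f' ⊛ g
⊛-congˡ g f≈f' m k =
  sumTo-cong m λ i _ → sumTo-cong k λ j _ → cong (_*ℤ g (m ∸ i) (k ∸ j)) (f≈f' i j)

-- commutativity, by reversing both summation ranges
⊛-comm : ∀ f g → f ⊛ g ≈ g ⊛ f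
⊛-comm f g m k = begin
  sumTo m (λ i → sumTo k (λ j → f i j *ℤ g (m ∸ i) (k ∸ j)))
    ≡⟨ sumTo-reverse m (λ i i' → sumTo k (λ j → f i j *ℤ g i' (k ∸ j))) ⟩
  sumTo m (λ i → sumTo k (λ j → f (m ∸ i) j *ℤ g i (k ∸ j)))
    ≡⟨ sumTo-cong m (λ i _ → sumTo-reverse k (λ j j' → f (m ∸ i) j *ℤ g i j')) ⟩
  sumTo m (λ i → sumTo k (λ j → f (m ∸ i) (k ∸ j) *ℤ g i j))
    ≡⟨ sumTo-cong m (λ i _ → sumTo-cong k (λ j _ → ℤP.*-comm (f (m ∸ i) (k ∸ j)) (g i j))) ⟩
  sumTo m (λ i → sumTo k (λ j → g i j *ℤ f (m ∸ i) (k ∸ j))) ∎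
  where open ≡-Reasoning

⊛-distribˡ : ∀ f g h → (f ⊕ g) ⊛ h ≈ f ⊛ h ⊕ g ⊛ h
⊛-distribˡ f g h m k = begin
  sumTo m (λ i → sumTo k (λ j → (f i j +ℤ g i j) *ℤ h (m ∸ i) (k ∸ j)))
    ≡⟨ sumTo-cong m (λ i _ → sumTo-cong k λ j _ →
         ℤP.*-distribʳ-+ (h (m ∸ i) (k ∸ j)) (f i j) (g i j)) ⟩
  sumTo m (λ i → sumTo k (λ j → f i j *ℤ h (m ∸ i) (k ∸ j) +ℤ g i j *ℤ h (m ∸ i) (k ∸ j)))
    ≡⟨ sumTo-cong m (λ i _ → sumTo-+ k _ _) ⟩
  sumTo m (λ i → sumTo k (λ j → f i j *ℤ h (m ∸ i) (k ∸ j))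
                 +ℤ sumTo k (λ j → g i j *ℤ h (m ∸ i) (k ∸ j)))
    ≡⟨ sumTo-+ m _ _ ⟩
  (f ⊛ h) m k +ℤ (g ⊛ h) m k ∎
  where open ≡-Reasoning

-- monomial factors can be pulled out of a product: each step of x (resp. q) drops
-- the vanishing first term of the outer (resp. inner) sum
⊛-shiftˡ : ∀ a c f g → shift a c f ⊛ g ≈ shift a c (f ⊛ g)
⊛-shiftˡ zero    zero    f g m       k       = refl
⊛-shiftˡ (suc a) c       f g zero    k       =
  sumTo-zero k λ j _ → ℤP.*-zeroˡ (g 0 (k ∸ j))
⊛-shiftˡ (suc a) c       f g (suc m) k       =
  trans (sumTo-front m _)
        (trans (cong₂ _+ℤ_ (sumTo-zero k λ j _ → ℤP.*-zeroˡ (g (suc m) (k ∸ j)))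
                           (⊛-shiftˡ a c f g m k))
               (ℤP.+-identityˡ _))
⊛-shiftˡ zero    (suc c) f g m       zero    =
  sumTo-zero m λ i _ → ℤP.*-zeroˡ (g (m ∸ i) 0)
⊛-shiftˡ zero    (suc c) f g m       (suc k) =
  trans (sumTo-cong m λ i _ →
           trans (sumTo-front k λ j → shift zero (suc c) f i j *ℤ g (m ∸ i) (suc k ∸ j))
                 (trans (cong (_+ℤ sumTo k λ j → shift zero c f i j *ℤ g (m ∸ i) (k ∸ j))
                              (ℤP.*-zeroˡ (g (m ∸ i) (suc k))))
                        (ℤP.+-identityˡ _)))
        (⊛-shiftˡ zero c f g m k)

-- 1 is a unit: only the term (i, j) = (0, 0) survives
⊛-unitˡ : ∀ f → oneS ⊛ f ≈ f
⊛-unitˡ f m k =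
  trans (sumTo-head m _ (λ i → sumTo-zero k λ j _ → ℤP.*-zeroˡ (f (m ∸ suc i) (k ∸ j))))
        (trans (sumTo-head k _ (λ j → ℤP.*-zeroˡ (f m (k ∸ suc j)))) (ℤP.*-identityˡ (f m k)))

⊛-unitʳ : ∀ f → f ⊛ oneS ≈ f
⊛-unitʳ f = ≈-trans (⊛-comm f oneS) (⊛-unitˡ f)

rec-⊛ʳ : ∀ {f g} d h → f ≈ g ⊕ shift 0 d f → f ⊛ h ≈ g ⊛ h ⊕ shift 0 d (f ⊛ h)
rec-⊛ʳ {f} {g} d h rec m k =
  trans (⊛-congˡ {f} {g ⊕ shift 0 d f} h rec m k)
        (trans (⊛-distribˡ g (shift 0 d f) h m k)
               (cong ((g ⊛ h) m k +ℤ_) (⊛-shiftˡ 0 d f h m k)))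

rec-⊛ˡ : ∀ {f g} d h → f ≈ g ⊕ shift 0 d f → h ⊛ f ≈ h ⊛ g ⊕ shift 0 d (h ⊛ f)
rec-⊛ˡ {f} {g} d h rec m k =
  trans (⊛-comm h f m k)
        (trans (rec-⊛ʳ {f} {g} d h rec m k)
               (cong₂ _+ℤ_ (⊛-comm g h m k) (shift-cong 0 d (⊛-comm f h) m k)))

[_] : ∀ {a} {A : Set a} → Dec A → ℤ
[ a? ] = if ⌊ a? ⌋ then + 1 else + 0

⌊⌋-⇔ : ∀ {a b} {A : Set a} {B : Set b} → A ⇔ B → (a? : Dec A) (b? : Dec B) → ⌊ a? ⌋ ≡ ⌊ b? ⌋
⌊⌋-⇔ A⇔B a? b? = trans (isYes≗does a?) (trans (does-⇔ A⇔B a? b?) (sym (isYes≗does b?)))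

suc-⇔ : ∀ {m n} → suc m ≡ suc n ⇔ m ≡ n
suc-⇔ = mk⇔ ℕP.suc-injective (cong suc)

mono-shift : ∀ a b → mono a b ≈ shift a b oneS
mono-shift zero    zero    m       k       = refl
mono-shift (suc a) b       zero    k       = refl
mono-shift (suc a) b       (suc m) k       =
  trans (cong (λ t → if t ∧ ⌊ k ℕ.≟ b ⌋ then + 1 else + 0) (⌊⌋-⇔ suc-⇔ (suc m ℕ.≟ suc a) (m ℕ.≟ a)))
        (mono-shift a b m k)
mono-shift zero    (suc b) m       zero    =
  cong (λ t → if t then + 1 else + 0) (∧-zeroʳ ⌊ m ℕ.≟ 0 ⌋)
mono-shift zero    (suc b) m       (suc k) =
  trans (cong (λ t → if ⌊ m ℕ.≟ 0 ⌋ ∧ t then + 1 else + 0) (⌊⌋-⇔ suc-⇔ (suc k ℕ.≟ suc b) (k ℕ.≟ b)))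
        (mono-shift zero b m k)

monoHalf-even : ∀ a e → monoHalf a (+ (2 * e)) ≈ mono a e
monoHalf-even a e m k =
  cong (λ t → if ⌊ m ℕ.≟ a ⌋ ∧ t then + 1 else + 0)
       (⌊⌋-⇔ (mk⇔ (λ eq → ℕP.*-cancelˡ-≡ k e 2 (ℤP.+-injective eq)) (cong λ x → + (2 * x)))
             (+ (2 * k) ℤ.≟ + (2 * e)) (k ℕ.≟ e))

lift-closed : ∀ c (g : ℕ → ℤ) k → lift c g k ≡ (if ⌊ c ℕ.≤? k ⌋ then g (k ∸ c) else + 0)
lift-closed zero    g k       = refl
lift-closed (suc c) g zero    = refl
lift-closed (suc c) g (suc k) =
  trans (lift-closed c g k)
        (cong (λ t → if t then g (k ∸ c) else + 0)
              (⌊⌋-⇔ (mk⇔ s≤s s≤s⁻¹) (c ℕ.≤? k) (suc c ℕ.≤? suc k)))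

substXq3-lift : ∀ f m k → substXq3 f m k ≡ lift (3 * m) (f m) k
substXq3-lift f m k = sym (lift-closed (3 * m) (f m) k)

geomInv-rec : ∀ d → geomInv (suc d) ≈ oneS ⊕ shift 0 (suc d) (geomInv (suc d))
geomInv-rec d (suc m) k = sym (trans (ℤP.+-identityˡ _) (lift-zero (suc d) k))
geomInv-rec d zero    k with suc d ℕ.≤? k
... | no k≱1+d =
  sym (trans (cong ([ k ℕ.≟ 0 ] +ℤ_) (lift-below (suc d) _ (ℕP.≰⇒> k≱1+d)))
             (trans (ℤP.+-identityʳ _)
                    (cong (λ t → if t then + 1 else + 0) (⌊⌋-⇔ below (k ℕ.≟ 0) (suc d ÷.∣? k)))))
  where
  -- below 1+d the only multiple of 1+d is 0
  below : k ≡ 0 ⇔ suc d ÷.∣ k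
  below = mk⇔ (λ { refl → suc d ÷.∣0 }) (only-zero k k≱1+d)
    where
    only-zero : ∀ k → ¬ suc d ≤ k → suc d ÷.∣ k → k ≡ 0
    only-zero zero    _       _   = refl
    only-zero (suc k) k≱1+d d∣k = contradiction (÷.∣⇒≤ d∣k) k≱1+d
... | yes 1+d≤k with ℕP.m≤n⇒∃[o]m+o≡n 1+d≤k
...   | r , refl =
  sym (trans (ℤP.+-identityˡ _)
             (trans (lift-at (suc d) _ r)
                    (cong (λ t → if t then + 1 else + 0)
                          (⌊⌋-⇔ (mk⇔ (÷.∣m∣n⇒∣m+n ÷.∣-refl) (λ d∣d+r → ÷.∣m+n∣m⇒∣n d∣d+r ÷.∣-refl))
                                (suc d ÷.∣? r) (suc d ÷.∣? (suc d + r))))))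

pochInv-rec : ∀ a n → pochInv (suc a) (suc n) ≈
              pochInv (suc a) n ⊕ shift 0 (suc a * suc n) (pochInv (suc a) (suc n))
pochInv-rec a n m k =
  trans (rec-⊛ˡ {geomInv (suc a * suc n)} {oneS} (suc a * suc n) (pochInv (suc a) n)
                (geomInv-rec (n + a * suc n)) m k)
        (cong (_+ℤ shift 0 (suc a * suc n) (pochInv (suc a) (suc n)) m k)
              (⊛-unitʳ (pochInv (suc a) n) m k))

XFree : Series → Set
XFree f = ∀ m k → f (suc m) k ≡ + 0

⊛-XFree : ∀ {f g} → XFree f → XFree g → XFree (f ⊛ g)
⊛-XFree {f} {g} f₀ g₀ m k = sumTo-zero (suc m) λ i _ → sumTo-zero k λ j _ → vanish i j
  where
  vanish : ∀ i j → f i j *ℤ g (suc m ∸ i) (k ∸ j) ≡ + 0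
  vanish zero    j = trans (cong (f 0 j *ℤ_) (g₀ m (k ∸ j))) (ℤP.*-zeroʳ (f 0 j))
  vanish (suc i) j = trans (cong (_*ℤ g (m ∸ i) (k ∸ j)) (f₀ i j)) (ℤP.*-zeroˡ (g (m ∸ i) (k ∸ j)))

pochInv-XFree : ∀ a n → XFree (pochInv a n)
pochInv-XFree a zero    m k = refl
pochInv-XFree a (suc n)     =
  ⊛-XFree {pochInv a n} {geomInv (a * suc n)} (pochInv-XFree a n) (λ m k → refl)

-- The family W(α,β,γ) and its summands

Par : Set
Par = ℕ × ℕ × ℕ

deg : ℕ → ℕ → ℕ → ℕ
deg n₁ n₂ n₃ = n₁ + 2 * n₂ + 3 * n₃

-- triangular numbers: tri n = n(n-1)/2
tri : ℕ → ℕ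
tri zero    = 0
tri (suc n) = tri n + n

expo : Par → ℕ → ℕ → ℕ → ℕ
expo (α , β , γ) n₁ n₂ n₃ = tri (deg n₁ n₂ n₃) + n₂ * n₂ + α * n₁ + β * n₂ + γ * n₃

-- the parameters of W(x q³):  W(p)(xq³) = W(p ⁺)
_⁺ : Par → Par
(α , β , γ) ⁺ = 3 + α , 6 + β , 9 + γ

-- Polynomial identities behind the recurrences; T stands for tri (deg …).
module ExponentArithmetic where
  open import Data.Nat.Tactic.RingSolver using (solve-∀)

  deg-suc₂ : ∀ i j u → i + 2 * (1 + j) + 3 * u ≡ 2 + (i + 2 * j + 3 * u)
  deg-suc₂ = solve-∀

  deg-suc₃ : ∀ i j u → i + 2 * j + 3 * (1 + u) ≡ 3 + (i + 2 * j + 3 * u)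
  deg-suc₃ = solve-∀

  rec₁ : ∀ T α β γ i j u →
         T + (i + 2 * j + 3 * u) + j * j + α * (1 + i) + β * j + γ * u
         ≡ α + (T + j * j + (1 + α) * i + (2 + β) * j + (3 + γ) * u)
  rec₁ = solve-∀

  rec₂ : ∀ T α β γ i j u →
         T + (i + 2 * j + 3 * u) + (1 + (i + 2 * j + 3 * u)) + (1 + j) * (1 + j)
           + α * i + β * (1 + j) + γ * u
         ≡ (2 + β) + (T + j * j + (2 + α) * i + (6 + β) * j + (6 + γ) * u)
  rec₂ = solve-∀

  rec₃ : ∀ T α β γ i j u →
         T + (i + 2 * j + 3 * u) + (1 + (i + 2 * j + 3 * u)) + (2 + (i + 2 * j + 3 * u))
           + j * j + α * i + β * j + γ * (1 + u)
         ≡ (3 + γ) + (T + j * j + (3 + α) * i + (6 + β) * j + (9 + γ) * u)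
  rec₃ = solve-∀

  raise₁ : ∀ T s α β γ i j u →
           T + s + (1 + α) * i + β * j + γ * u ≡ T + s + α * i + β * j + γ * u + 1 * i
  raise₁ = solve-∀

  raise₂ : ∀ T s α β γ i j u →
           T + s + α * i + (2 + β) * j + γ * u ≡ T + s + α * i + β * j + γ * u + 2 * j
  raise₂ = solve-∀

  raise₃ : ∀ T s α β γ i j u →
           T + s + α * i + β * j + (3 + γ) * u ≡ T + s + α * i + β * j + γ * u + 3 * u
  raise₃ = solve-∀

  subst₃ : ∀ T s α β γ i j u →
           T + s + (3 + α) * i + (6 + β) * j + (9 + γ) * u
           ≡ 3 * (i + 2 * j + 3 * u) + (T + s + α * i + β * j + γ * u)
  subst₃ = solve-∀

deg-suc₂ : ∀ i j u → deg i (suc j) u ≡ 2 + deg i j u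
deg-suc₂ = ExponentArithmetic.deg-suc₂

deg-suc₃ : ∀ i j u → deg i j (suc u) ≡ 3 + deg i j u
deg-suc₃ = ExponentArithmetic.deg-suc₃

expo-rec₁ : ∀ α β γ i j u → expo (α , β , γ) (suc i) j u ≡ α + expo (suc α , 2 + β , 3 + γ) i j u
expo-rec₁ α β γ i j u = ExponentArithmetic.rec₁ (tri (deg i j u)) α β γ i j u

expo-rec₂ : ∀ α β γ i j u →
            expo (α , β , γ) i (suc j) u ≡ (2 + β) + expo (2 + α , 6 + β , 6 + γ) i j u
expo-rec₂ α β γ i j u =
  trans (cong (λ D → tri D + suc j * suc j + α * i + β * suc j + γ * u) (deg-suc₂ i j u))
        (ExponentArithmetic.rec₂ (tri (deg i j u)) α β γ i j u)

expo-rec₃ : ∀ α β γ i j u →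
            expo (α , β , γ) i j (suc u) ≡ (3 + γ) + expo (3 + α , 6 + β , 9 + γ) i j u
expo-rec₃ α β γ i j u =
  trans (cong (λ D → tri D + j * j + α * i + β * j + γ * suc u) (deg-suc₃ i j u))
        (ExponentArithmetic.rec₃ (tri (deg i j u)) α β γ i j u)

expo-raise₁ : ∀ α β γ i j u → expo (suc α , β , γ) i j u ≡ expo (α , β , γ) i j u + 1 * i
expo-raise₁ α β γ i j u = ExponentArithmetic.raise₁ (tri (deg i j u)) (j * j) α β γ i j u

expo-raise₂ : ∀ α β γ i j u → expo (α , 2 + β , γ) i j u ≡ expo (α , β , γ) i j u + 2 * j
expo-raise₂ α β γ i j u = ExponentArithmetic.raise₂ (tri (deg i j u)) (j * j) α β γ i j u

expo-raise₃ : ∀ α β γ i j u → expo (α , β , 3 + γ) i j u ≡ expo (α , β , γ) i j u + 3 * u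
expo-raise₃ α β γ i j u = ExponentArithmetic.raise₃ (tri (deg i j u)) (j * j) α β γ i j u

expo-⁺ : ∀ p i j u → expo (p ⁺) i j u ≡ 3 * deg i j u + expo p i j u
expo-⁺ (α , β , γ) i j u = ExponentArithmetic.subst₃ (tri (deg i j u)) (j * j) α β γ i j u

P : ℕ → ℕ → ℕ → Series
P n₁ n₂ n₃ = pochInv 1 n₁ ⊛ pochInv 2 n₂ ⊛ pochInv 3 n₃

P-XFree : ∀ n₁ n₂ n₃ → XFree (P n₁ n₂ n₃)
P-XFree n₁ n₂ n₃ =
  ⊛-XFree {pochInv 1 n₁ ⊛ pochInv 2 n₂} {pochInv 3 n₃}
    (⊛-XFree {pochInv 1 n₁} {pochInv 2 n₂} (pochInv-XFree 1 n₁) (pochInv-XFree 2 n₂))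
    (pochInv-XFree 3 n₃)

P-rec₁ : ∀ i n₂ n₃ → P (suc i) n₂ n₃ ≈ P i n₂ n₃ ⊕ shift 0 (1 * suc i) (P (suc i) n₂ n₃)
P-rec₁ i n₂ n₃ =
  rec-⊛ʳ {pochInv 1 (suc i) ⊛ pochInv 2 n₂} {pochInv 1 i ⊛ pochInv 2 n₂} (1 * suc i) (pochInv 3 n₃)
    (rec-⊛ʳ {pochInv 1 (suc i)} {pochInv 1 i} (1 * suc i) (pochInv 2 n₂) (pochInv-rec 0 i))

P-rec₂ : ∀ n₁ j n₃ → P n₁ (suc j) n₃ ≈ P n₁ j n₃ ⊕ shift 0 (2 * suc j) (P n₁ (suc j) n₃)
P-rec₂ n₁ j n₃ =
  rec-⊛ʳ {pochInv 1 n₁ ⊛ pochInv 2 (suc j)} {pochInv 1 n₁ ⊛ pochInv 2 j} (2 * suc j) (pochInv 3 n₃)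
    (rec-⊛ˡ {pochInv 2 (suc j)} {pochInv 2 j} (2 * suc j) (pochInv 1 n₁) (pochInv-rec 1 j))

P-rec₃ : ∀ n₁ n₂ u → P n₁ n₂ (suc u) ≈ P n₁ n₂ u ⊕ shift 0 (3 * suc u) (P n₁ n₂ (suc u))
P-rec₃ n₁ n₂ u =
  rec-⊛ˡ {pochInv 3 (suc u)} {pochInv 3 u} (3 * suc u) (pochInv 1 n₁ ⊛ pochInv 2 n₂)
    (pochInv-rec 2 u)

term : Par → ℕ → ℕ → ℕ → Series
term p n₁ n₂ n₃ = shift (deg n₁ n₂ n₃) (expo p n₁ n₂ n₃) (P n₁ n₂ n₃)

term-XOrder : ∀ p n₁ n₂ n₃ → XOrder (deg n₁ n₂ n₃) (term p n₁ n₂ n₃)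
term-XOrder p n₁ n₂ n₃ m k m<deg = lift-below (deg n₁ n₂ n₃) _ m<deg

deg≥₁ : ∀ n₁ n₂ n₃ → n₁ ≤ deg n₁ n₂ n₃
deg≥₁ n₁ n₂ n₃ = ℕP.≤-trans (ℕP.m≤m+n n₁ (2 * n₂)) (ℕP.m≤m+n _ (3 * n₃))

deg≥₂ : ∀ n₁ n₂ n₃ → n₂ ≤ deg n₁ n₂ n₃
deg≥₂ n₁ n₂ n₃ =
  ℕP.≤-trans (ℕP.m≤m+n n₂ _) (ℕP.≤-trans (ℕP.m≤n+m (2 * n₂) n₁) (ℕP.m≤m+n _ (3 * n₃)))

deg≥₃ : ∀ n₁ n₂ n₃ → n₃ ≤ deg n₁ n₂ n₃
deg≥₃ n₁ n₂ n₃ = ℕP.≤-trans (ℕP.m≤m+n n₃ _) (ℕP.m≤n+m (3 * n₃) (n₁ + 2 * n₂))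

shift-step : ∀ a c d N e {P₀ P₁ : Series} {N₁ e₁ e₁'} → P₁ ≈ P₀ ⊕ shift 0 d P₁ →
             N₁ ≡ a + N → e₁ ≡ c + e → e₁' ≡ e₁ + d →
             shift N₁ e₁ P₁ ≈ shift N₁ e₁' P₁ ⊕ shift a c (shift N e P₀)
shift-step a c d N e {P₀} {P₁} rec refl refl refl m k = begin
  shift (a + N) (c + e) P₁ m k
    ≡⟨ shift-cong (a + N) (c + e) rec m k ⟩
  shift (a + N) (c + e) (P₀ ⊕ shift 0 d P₁) m k
    ≡⟨ shift-⊕ (a + N) (c + e) P₀ (shift 0 d P₁) m k ⟩
  shift (a + N) (c + e) P₀ m k +ℤ shift (a + N) (c + e) (shift 0 d P₁) m k
    ≡⟨ ℤP.+-comm (shift (a + N) (c + e) P₀ m k) _ ⟩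
  shift (a + N) (c + e) (shift 0 d P₁) m k +ℤ shift (a + N) (c + e) P₀ m k
    ≡⟨ cong₂ _+ℤ_ (shift-q (a + N) (c + e) d P₁ m k) (sym (shift-shift a c N e P₀ m k)) ⟩
  shift (a + N) (c + e + d) P₁ m k +ℤ shift a c (shift N e P₀) m k ∎
  where open ≡-Reasoning

term-rec₁ : ∀ α β γ i j u →
  term (α , β , γ) (suc i) j u
  ≈ term (suc α , β , γ) (suc i) j u ⊕ shift 1 α (term (suc α , 2 + β , 3 + γ) i j u)
term-rec₁ α β γ i j u =
  shift-step 1 α (1 * suc i) (deg i j u) (expo (suc α , 2 + β , 3 + γ) i j u) (P-rec₁ i j u)
    refl (expo-rec₁ α β γ i j u) (expo-raise₁ α β γ (suc i) j u)

term-rec₂ : ∀ α β γ i j u →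
  term (α , β , γ) i (suc j) u
  ≈ term (α , 2 + β , γ) i (suc j) u ⊕ shift 2 (2 + β) (term (2 + α , 6 + β , 6 + γ) i j u)
term-rec₂ α β γ i j u =
  shift-step 2 (2 + β) (2 * suc j) (deg i j u) (expo (2 + α , 6 + β , 6 + γ) i j u) (P-rec₂ i j u)
    (deg-suc₂ i j u) (expo-rec₂ α β γ i j u) (expo-raise₂ α β γ i (suc j) u)

term-rec₃ : ∀ α β γ i j u →
  term (α , β , γ) i j (suc u)
  ≈ term (α , β , 3 + γ) i j (suc u) ⊕ shift 3 (3 + γ) (term (3 + α , 6 + β , 9 + γ) i j u)
term-rec₃ α β γ i j u =
  shift-step 3 (3 + γ) (3 * suc u) (deg i j u) (expo (3 + α , 6 + β , 9 + γ) i j u) (P-rec₃ i j u)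
    (deg-suc₃ i j u) (expo-rec₃ α β γ i j u) (expo-raise₃ α β γ i j (suc u))

Σ≤ : ℕ → (ℕ → Series) → Series
Σ≤ B f m k = sumTo B (λ n → f n m k)

Σ≤-cong : ∀ B {f g : ℕ → Series} → (∀ n → f n ≈ g n) → Σ≤ B f ≈ Σ≤ B g
Σ≤-cong B f≈g m k = sumTo-cong B λ n _ → f≈g n m k

Σ≤-shift : ∀ B a c f → Σ≤ B (λ n → shift a c (f n)) ≈ shift a c (Σ≤ B f)
Σ≤-shift zero    a c f m k = refl
Σ≤-shift (suc B) a c f m k =
  trans (cong (_+ℤ shift a c (f (suc B)) m k) (Σ≤-shift B a c f m k))
        (sym (shift-⊕ a c (Σ≤ B f) (f (suc B)) m k))

Σ≤-XOrder : ∀ B {D f} → (∀ n → XOrder D (f n)) → XOrder D (Σ≤ B f)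
Σ≤-XOrder B ord m k m<D = sumTo-zero B λ n _ → ord n m k m<D

Σ≤-split : ∀ B a c {D} {f g h : ℕ → Series} →
           (∀ n → f n ≈[ D ] g n ⊕ shift a c (h n)) →
           Σ≤ B f ≈[ D ] Σ≤ B g ⊕ shift a c (Σ≤ B h)
Σ≤-split B a c {g = g} {h} split m k m≤D =
  trans (sumTo-cong B λ n _ → split n m k m≤D)
        (trans (sumTo-+ B _ _) (cong (Σ≤ B g m k +ℤ_) (Σ≤-shift B a c h m k)))

Σ≤-telescope : ∀ B a c {D} {f g h : ℕ → Series} →
               f 0 ≈[ D ] g 0 → (∀ i → f (suc i) ≈[ D ] g (suc i) ⊕ shift a c (h i)) →
               shift a c (h B) ≈[ D ] 𝟘 →
               Σ≤ B f ≈[ D ] Σ≤ B g ⊕ shift a c (Σ≤ B h)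
Σ≤-telescope B a c {f = f} {g} {h} base step last m k m≤D = begin
  Σ≤ B f m k                                      ≡⟨ sym (ℤP.+-identityʳ _) ⟩
  Σ≤ B f m k +ℤ + 0                               ≡⟨ cong (Σ≤ B f m k +ℤ_) (sym (last m k m≤D)) ⟩
  Σ≤ B f m k +ℤ shift a c (h B) m k
    ≡⟨ sumTo-telescope B (λ n → f n m k) (λ n → g n m k) (λ n → shift a c (h n) m k)
                       (base m k m≤D) (λ i → step i m k m≤D) ⟩
  Σ≤ B g m k +ℤ Σ≤ B (λ n → shift a c (h n)) m k  ≡⟨ cong (Σ≤ B g m k +ℤ_) (Σ≤-shift B a c h m k) ⟩
  Σ≤ B g m k +ℤ shift a c (Σ≤ B h) m k            ∎
  where open ≡-Reasoning

shift-vanish : ∀ a c {B h} → XOrder B h → shift (suc a) c h ≈[ B ] 𝟘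
shift-vanish a c {B} ord =
  XOrder⇒≈𝟘 (XOrder-weaken (s≤s (ℕP.m≤n+m B a)) (XOrder-shift (suc a) c ord))

Wtrunc : ℕ → Par → Series
Wtrunc B p = Σ≤ B λ n₁ → Σ≤ B λ n₂ → Σ≤ B λ n₃ → term p n₁ n₂ n₃

-- W(p): only n₁, n₂, n₃ ≤ m contribute to the coefficient of x^m
W : Par → Series
W p m k = Wtrunc m p m k

-- The truncated recurrences, valid up to x-degree B: (R_r) telescopes in the index n_r
-- using the termwise recurrence term-rec_r.  The n_r = 0 summands agree because the raised
-- coefficient multiplies n_r = 0, and the last correction has x-degree above B.
Wtrunc-rec₁ : ∀ B α β γ →
  Wtrunc B (α , β , γ)
  ≈[ B ] Wtrunc B (suc α , β , γ) ⊕ shift 1 α (Wtrunc B (suc α , 2 + β , 3 + γ))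
Wtrunc-rec₁ B α β γ =
  Σ≤-telescope B 1 α (λ _ _ _ → refl)
    (λ i → Σ≤-split B 1 α λ j → Σ≤-split B 1 α λ u → ≈⇒≈[] (term-rec₁ α β γ i j u))
    (shift-vanish 0 α (Σ≤-XOrder B λ j → Σ≤-XOrder B λ u →
       XOrder-weaken (deg≥₁ B j u) (term-XOrder (suc α , 2 + β , 3 + γ) B j u)))

Wtrunc-rec₂ : ∀ B α β γ →
  Wtrunc B (α , β , γ)
  ≈[ B ] Wtrunc B (α , 2 + β , γ) ⊕ shift 2 (2 + β) (Wtrunc B (2 + α , 6 + β , 6 + γ))
Wtrunc-rec₂ B α β γ =
  Σ≤-split B 2 (2 + β) λ i → Σ≤-telescope B 2 (2 + β) (λ _ _ _ → refl)
    (λ j → Σ≤-split B 2 (2 + β) λ u → ≈⇒≈[] (term-rec₂ α β γ i j u))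
    (shift-vanish 1 (2 + β) (Σ≤-XOrder B λ u →
       XOrder-weaken (deg≥₂ i B u) (term-XOrder (2 + α , 6 + β , 6 + γ) i B u)))

Wtrunc-rec₃ : ∀ B α β γ →
  Wtrunc B (α , β , γ)
  ≈[ B ] Wtrunc B (α , β , 3 + γ) ⊕ shift 3 (3 + γ) (Wtrunc B (3 + α , 6 + β , 9 + γ))
Wtrunc-rec₃ B α β γ =
  Σ≤-split B 3 (3 + γ) λ i → Σ≤-split B 3 (3 + γ) λ j → Σ≤-telescope B 3 (3 + γ) (λ _ _ _ → refl)
    (λ u → ≈⇒≈[] (term-rec₃ α β γ i j u))
    (shift-vanish 2 (3 + γ)
       (XOrder-weaken (deg≥₃ i j B) (term-XOrder (3 + α , 6 + β , 9 + γ) i j B)))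

Wtrunc-extend : ∀ {B B'} p → B ≤ B' → Wtrunc B' p ≈[ B ] Wtrunc B p
Wtrunc-extend {B} {B'} p B≤B' m k m≤B = begin
  sumTo B' (λ i → sumTo B' (λ j → sumTo B' (λ u → term p i j u m k)))
    ≡⟨ sumTo-cong B' (λ i _ → sumTo-cong B' λ j _ → sumTo-extend _ B≤B' λ u B<u →
         term-XOrder p i j u m k (beyond B<u (deg≥₃ i j u))) ⟩
  sumTo B' (λ i → sumTo B' (λ j → sumTo B (λ u → term p i j u m k)))
    ≡⟨ sumTo-cong B' (λ i _ → sumTo-extend _ B≤B' λ j B<j →
         Σ≤-XOrder B (λ u → XOrder-weaken (deg≥₂ i j u) (term-XOrder p i j u)) m k
           (beyond B<j ℕP.≤-refl)) ⟩
  sumTo B' (λ i → sumTo B (λ j → sumTo B (λ u → term p i j u m k)))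
    ≡⟨ sumTo-extend _ B≤B' (λ i B<i →
         Σ≤-XOrder B (λ j → Σ≤-XOrder B λ u → XOrder-weaken (deg≥₁ i j u) (term-XOrder p i j u)) m k
           (beyond B<i ℕP.≤-refl)) ⟩
  sumTo B (λ i → sumTo B (λ j → sumTo B (λ u → term p i j u m k))) ∎
  where
  open ≡-Reasoning
  beyond : ∀ {n d} → B < n → n ≤ d → m < d
  beyond B<n n≤d = ℕP.<-≤-trans (ℕP.≤-<-trans m≤B B<n) n≤d

Wtrunc≈W : ∀ B p → Wtrunc B p ≈[ B ] W p
Wtrunc≈W B p m k m≤B = Wtrunc-extend p m≤B m k ℕP.≤-refl

untruncate : ∀ p p₁ p₂ a c → (∀ B → Wtrunc B p ≈[ B ] Wtrunc B p₁ ⊕ shift a c (Wtrunc B p₂)) →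
             W p ≈ W p₁ ⊕ shift a c (W p₂)
untruncate p p₁ p₂ a c rec m k =
  trans (rec m m k ℕP.≤-refl) (cong (W p₁ m k +ℤ_) (shift-cong≤ a c (Wtrunc≈W m p₂) m k ℕP.≤-refl))

W-rec₁ : ∀ α β γ → W (α , β , γ) ≈ W (suc α , β , γ) ⊕ shift 1 α (W (suc α , 2 + β , 3 + γ))
W-rec₁ α β γ =
  untruncate (α , β , γ) (suc α , β , γ) (suc α , 2 + β , 3 + γ) 1 α λ B → Wtrunc-rec₁ B α β γ

W-rec₂ : ∀ α β γ → W (α , β , γ) ≈ W (α , 2 + β , γ) ⊕ shift 2 (2 + β) (W (2 + α , 6 + β , 6 + γ))
W-rec₂ α β γ =
  untruncate (α , β , γ) (α , 2 + β , γ) (2 + α , 6 + β , 6 + γ) 2 (2 + β) λ B → Wtrunc-rec₂ B α β γ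

W-rec₃ : ∀ α β γ → W (α , β , γ) ≈ W (α , β , 3 + γ) ⊕ shift 3 (3 + γ) (W (3 + α , 6 + β , 9 + γ))
W-rec₃ α β γ =
  untruncate (α , β , γ) (α , β , 3 + γ) (3 + α , 6 + β , 9 + γ) 3 (3 + γ) λ B → Wtrunc-rec₃ B α β γ

-- (S): the substitution x ↦ xq³

substXq3-cong : ∀ {f g} → f ≈ g → substXq3 f ≈ substXq3 g
substXq3-cong f≈g m k = cong (λ v → if ⌊ 3 * m ℕ.≤? k ⌋ then v else + 0) (f≈g m (k ∸ 3 * m))

substXq3-Σ≤ : ∀ B f → substXq3 (Σ≤ B f) ≈ Σ≤ B (λ n → substXq3 (f n))
substXq3-Σ≤ B f m k with ⌊ 3 * m ℕ.≤? k ⌋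
... | true  = refl
... | false = sym (sumTo-zero B λ _ _ → refl)

substXq3-shift : ∀ N e {P₀} → XFree P₀ → substXq3 (shift N e P₀) ≈ shift N (3 * N + e) P₀
substXq3-shift N e {P₀} free m k with N ℕ.≤? m
... | no m≱N =
  trans (substXq3-lift (shift N e P₀) m k)
        (trans (lift-cong (3 * m) (λ k' → lift-below N (λ i → lift e (P₀ i) k') (ℕP.≰⇒> m≱N)) k)
               (trans (lift-zero (3 * m) k) (sym (lift-below N _ (ℕP.≰⇒> m≱N)))))
... | yes N≤m with ℕP.m≤n⇒∃[o]m+o≡n N≤m
...   | zero , refl = begin
  substXq3 (shift N e P₀) (N + 0) k
    ≡⟨ substXq3-lift (shift N e P₀) (N + 0) k ⟩
  lift (3 * (N + 0)) (λ k' → shift N e P₀ (N + 0) k') k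
    ≡⟨ lift-cong (3 * (N + 0)) (λ k' → lift-at N (λ i → lift e (P₀ i) k') 0) k ⟩
  lift (3 * (N + 0)) (lift e (P₀ 0)) k
    ≡⟨ lift-lift (3 * (N + 0)) e (P₀ 0) k ⟩
  lift (3 * (N + 0) + e) (P₀ 0) k
    ≡⟨ cong (λ t → lift (3 * t + e) (P₀ 0) k) (ℕP.+-identityʳ N) ⟩
  lift (3 * N + e) (P₀ 0) k
    ≡⟨ sym (lift-at N _ 0) ⟩
  shift N (3 * N + e) P₀ (N + 0) k ∎
  where open ≡-Reasoning
...   | suc r , refl =
  trans (substXq3-lift (shift N e P₀) (N + suc r) k)
        (trans (lift-cong (3 * (N + suc r))
                          (λ k' → trans (lift-at N (λ i → lift e (P₀ i) k') (suc r))
                                        (x-free e k')) k)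
               (trans (lift-zero (3 * (N + suc r)) k)
                      (sym (trans (lift-at N (λ i → lift (3 * N + e) (P₀ i) k) (suc r))
                                  (x-free (3 * N + e) k)))))
  where
  x-free : ∀ c k → lift c (P₀ (suc r)) k ≡ + 0
  x-free c k = trans (lift-cong c (free r) k) (lift-zero c k)

term-⁺ : ∀ p n₁ n₂ n₃ → substXq3 (term p n₁ n₂ n₃) ≈ term (p ⁺) n₁ n₂ n₃
term-⁺ p n₁ n₂ n₃ m k =
  trans (substXq3-shift (deg n₁ n₂ n₃) (expo p n₁ n₂ n₃) (P-XFree n₁ n₂ n₃) m k)
        (cong (λ e → shift (deg n₁ n₂ n₃) e (P n₁ n₂ n₃) m k) (sym (expo-⁺ p n₁ n₂ n₃)))

Wtrunc-⁺ : ∀ B p → substXq3 (Wtrunc B p) ≈ Wtrunc B (p ⁺)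
Wtrunc-⁺ B p =
  ≈-trans (substXq3-Σ≤ B λ n₁ → Σ≤ B λ n₂ → Σ≤ B λ n₃ → term p n₁ n₂ n₃) (Σ≤-cong B λ n₁ →
  ≈-trans (substXq3-Σ≤ B λ n₂ → Σ≤ B λ n₃ → term p n₁ n₂ n₃) (Σ≤-cong B λ n₂ →
  ≈-trans (substXq3-Σ≤ B λ n₃ → term p n₁ n₂ n₃) (Σ≤-cong B λ n₃ → term-⁺ p n₁ n₂ n₃)))

W-⁺ : ∀ p → substXq3 (W p) ≈ W (p ⁺)
W-⁺ p m k = Wtrunc-⁺ m p m k

lin₁ lin₂ lin₃ : Par → ℤ
lin₁ (α , β , γ) = + (2 * α) ℤ.- + 1
lin₂ (α , β , γ) = + (2 * β) ℤ.- + 2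
lin₃ (α , β , γ) = + (2 * γ) ℤ.- + 3

twoQℕ : ℕ → ℕ → ℕ → ℕ
twoQℕ n₁ n₂ n₃ = n₁ * n₁ + 6 * (n₂ * n₂) + 9 * (n₃ * n₃)
                 + 4 * (n₁ * n₂) + 12 * (n₂ * n₃) + 6 * (n₁ * n₃)

module DoubledExponentArithmetic where
  open import Data.Nat.Tactic.RingSolver using (solve-∀)

  tri-step : ∀ T n → 2 * (T + n) + (1 + n) ≡ (2 * T + n) + (2 * n + 1)
  tri-step = solve-∀

  square-step : ∀ n → n * n + (2 * n + 1) ≡ (1 + n) * (1 + n)
  square-step = solve-∀

  double : ∀ T α β γ n₁ n₂ n₃ →
           2 * (T + n₂ * n₂ + α * n₁ + β * n₂ + γ * n₃) + (n₁ + 2 * n₂ + 3 * n₃)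
           ≡ (2 * T + (n₁ + 2 * n₂ + 3 * n₃)) + 2 * (n₂ * n₂) + 2 * α * n₁ + 2 * β * n₂ + 2 * γ * n₃
  double = solve-∀

  -- 2Q(n) = N² + 2n₂²
  square : ∀ α β γ n₁ n₂ n₃ →
           (n₁ + 2 * n₂ + 3 * n₃) * (n₁ + 2 * n₂ + 3 * n₃) + 2 * (n₂ * n₂)
             + 2 * α * n₁ + 2 * β * n₂ + 2 * γ * n₃
           ≡ n₁ * n₁ + 6 * (n₂ * n₂) + 9 * (n₃ * n₃)
             + 4 * (n₁ * n₂) + 12 * (n₂ * n₃) + 6 * (n₁ * n₃)
             + 2 * α * n₁ + 2 * β * n₂ + 2 * γ * n₃
  square = solve-∀

module IntegerArithmetic where
  open import Data.Integer.Tactic.RingSolver using (solve-∀)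

  unfold-lin : ∀ X A B C x₁ x₂ x₃ →
    X +ℤ (A ℤ.- + 1) *ℤ x₁ +ℤ (B ℤ.- + 2) *ℤ x₂ +ℤ (C ℤ.- + 3) *ℤ x₃
    ≡ (X +ℤ A *ℤ x₁ +ℤ B *ℤ x₂ +ℤ C *ℤ x₃) ℤ.- (x₁ +ℤ + 2 *ℤ x₂ +ℤ + 3 *ℤ x₃)
  unfold-lin = solve-∀

  cancel : ∀ a b → (a +ℤ b) ℤ.- b ≡ a
  cancel = solve-∀

tri-double : ∀ n → 2 * tri n + n ≡ n * n
tri-double zero    = refl
tri-double (suc n) =
  trans (DoubledExponentArithmetic.tri-step (tri n) n)
        (trans (cong (_+ (2 * n + 1)) (tri-double n)) (DoubledExponentArithmetic.square-step n))

expo-double : ∀ α β γ n₁ n₂ n₃ →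
  2 * expo (α , β , γ) n₁ n₂ n₃ + deg n₁ n₂ n₃
  ≡ twoQℕ n₁ n₂ n₃ + 2 * α * n₁ + 2 * β * n₂ + 2 * γ * n₃
expo-double α β γ n₁ n₂ n₃ =
  trans (DoubledExponentArithmetic.double (tri (deg n₁ n₂ n₃)) α β γ n₁ n₂ n₃)
  (trans (cong (λ t → t + 2 * (n₂ * n₂) + 2 * α * n₁ + 2 * β * n₂ + 2 * γ * n₃)
               (tri-double (deg n₁ n₂ n₃)))
         (DoubledExponentArithmetic.square α β γ n₁ n₂ n₃))

cast-linear : ∀ Q a b c n₁ n₂ n₃ →
  + (Q + a * n₁ + b * n₂ + c * n₃) ≡ + Q +ℤ + a *ℤ + n₁ +ℤ + b *ℤ + n₂ +ℤ + c *ℤ + n₃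
cast-linear Q a b c n₁ n₂ n₃ =
  trans (ℤP.pos-+ (Q + a * n₁ + b * n₂) (c * n₃)) (cong₂ _+ℤ_
  (trans (ℤP.pos-+ (Q + a * n₁) (b * n₂)) (cong₂ _+ℤ_
  (trans (ℤP.pos-+ Q (a * n₁)) (cong (+ Q +ℤ_) (ℤP.pos-* a n₁)))
  (ℤP.pos-* b n₂)))
  (ℤP.pos-* c n₃))

cast-deg : ∀ n₁ n₂ n₃ → + deg n₁ n₂ n₃ ≡ + n₁ +ℤ + 2 *ℤ + n₂ +ℤ + 3 *ℤ + n₃
cast-deg n₁ n₂ n₃ =
  trans (ℤP.pos-+ (n₁ + 2 * n₂) (3 * n₃)) (cong₂ _+ℤ_
  (trans (ℤP.pos-+ n₁ (2 * n₂)) (cong (+ n₁ +ℤ_) (ℤP.pos-* 2 n₂)))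
  (ℤP.pos-* 3 n₃))

twoQ-lin : ∀ p n₁ n₂ n₃ →
  twoQ n₁ n₂ n₃ +ℤ lin₁ p *ℤ + n₁ +ℤ lin₂ p *ℤ + n₂ +ℤ lin₃ p *ℤ + n₃ ≡ + (2 * expo p n₁ n₂ n₃)
twoQ-lin (α , β , γ) n₁ n₂ n₃ = begin
  twoQ n₁ n₂ n₃ +ℤ lin₁ p *ℤ + n₁ +ℤ lin₂ p *ℤ + n₂ +ℤ lin₃ p *ℤ + n₃
    ≡⟨ IntegerArithmetic.unfold-lin (twoQ n₁ n₂ n₃) (+ (2 * α)) (+ (2 * β)) (+ (2 * γ))
                                    (+ n₁) (+ n₂) (+ n₃) ⟩
  (twoQ n₁ n₂ n₃ +ℤ + (2 * α) *ℤ + n₁ +ℤ + (2 * β) *ℤ + n₂ +ℤ + (2 * γ) *ℤ + n₃) ℤ.- N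
    ≡⟨ cong (ℤ._- N) (sym (cast-linear (twoQℕ n₁ n₂ n₃) (2 * α) (2 * β) (2 * γ) n₁ n₂ n₃)) ⟩
  + (twoQℕ n₁ n₂ n₃ + 2 * α * n₁ + 2 * β * n₂ + 2 * γ * n₃) ℤ.- N
    ≡⟨ cong (λ t → + t ℤ.- N) (sym (expo-double α β γ n₁ n₂ n₃)) ⟩
  + (2 * e + deg n₁ n₂ n₃) ℤ.- N
    ≡⟨ cong (ℤ._- N) (trans (ℤP.pos-+ (2 * e) (deg n₁ n₂ n₃))
                            (cong (+ (2 * e) +ℤ_) (cast-deg n₁ n₂ n₃))) ⟩
  (+ (2 * e) +ℤ N) ℤ.- N
    ≡⟨ IntegerArithmetic.cancel (+ (2 * e)) N ⟩
  + (2 * e) ∎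
  where
  open ≡-Reasoning
  p = α , β , γ
  e = expo p n₁ n₂ n₃
  N = + n₁ +ℤ + 2 *ℤ + n₂ +ℤ + 3 *ℤ + n₃

monomial-⊛ : ∀ {M} a c f → M ≈ shift a c oneS → M ⊛ f ≈ shift a c f
monomial-⊛ {M} a c f M≈ = begin
  M ⊛ f                 ≈⟨ ⊛-congˡ f M≈ ⟩
  shift a c oneS ⊛ f    ≈⟨ ⊛-shiftˡ a c oneS f ⟩
  shift a c (oneS ⊛ f)  ≈⟨ shift-cong a c (⊛-unitˡ f) ⟩
  shift a c f           ∎
  where open ≈-Reasoning

summand-term : ∀ p n₁ n₂ n₃ → summand (lin₁ p) (lin₂ p) (lin₃ p) n₁ n₂ n₃ ≈ term p n₁ n₂ n₃
summand-term p n₁ n₂ n₃ = begin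
  monoHalf N (twoQ n₁ n₂ n₃ +ℤ lin₁ p *ℤ + n₁ +ℤ lin₂ p *ℤ + n₂ +ℤ lin₃ p *ℤ + n₃) ⊛ p₁ ⊛ p₂ ⊛ p₃
    ≈⟨ ⊛-congˡ p₃ (⊛-congˡ p₂ (monomial-⊛ N e p₁ M≈)) ⟩
  shift N e p₁ ⊛ p₂ ⊛ p₃
    ≈⟨ ⊛-congˡ p₃ (⊛-shiftˡ N e p₁ p₂) ⟩
  shift N e (p₁ ⊛ p₂) ⊛ p₃
    ≈⟨ ⊛-shiftˡ N e (p₁ ⊛ p₂) p₃ ⟩
  term p n₁ n₂ n₃ ∎
  where
  open ≈-Reasoning
  N = deg n₁ n₂ n₃
  e = expo p n₁ n₂ n₃
  p₁ = pochInv 1 n₁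
  p₂ = pochInv 2 n₂
  p₃ = pochInv 3 n₃
  M≈ : monoHalf N (twoQ n₁ n₂ n₃ +ℤ lin₁ p *ℤ + n₁ +ℤ lin₂ p *ℤ + n₂ +ℤ lin₃ p *ℤ + n₃)
       ≈ shift N e oneS
  M≈ m k = trans (cong (λ d → monoHalf N d m k) (twoQ-lin p n₁ n₂ n₃))
                 (trans (monoHalf-even N e m k) (mono-shift N e m k))

tripleSum-W : ∀ p → tripleSum (lin₁ p) (lin₂ p) (lin₃ p) ≈ W p
tripleSum-W p m k =
  sumTo-cong m λ n₁ _ → sumTo-cong m λ n₂ _ → sumTo-cong m λ n₃ _ → summand-term p n₁ n₂ n₃ m k

params : Block → Par
params b1 = 1 , 0 , 1
params b2 = 2 , 2 , 4
params b3 = 2 , 4 , 7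
params b4 = 3 , 4 , 7

blockSeries-W : ∀ b → blockSeries b ≈ W (params b)
blockSeries-W b1 = tripleSum-W (params b1)
blockSeries-W b2 = tripleSum-W (params b2)
blockSeries-W b3 = tripleSum-W (params b3)
blockSeries-W b4 = tripleSum-W (params b4)

-- Expansion trees

-- (a , c , p) stands for the series x^a q^c W(p)
Item : Set
Item = ℕ × ℕ × Par

itemSeries : Item → Series
itemSeries (a , c , p) = shift a c (W p)

⟦_⟧ : List Item → Series
⟦ []    ⟧ = 𝟘
⟦ x ∷ L ⟧ = itemSeries x ⊕ ⟦ L ⟧

shiftItem : ℕ → ℕ → Item → Item
shiftItem a c (a' , c' , p) = a + a' , c + c' , p

⟦⟧-++ : ∀ L L' → ⟦ L ++ L' ⟧ ≈ ⟦ L ⟧ ⊕ ⟦ L' ⟧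
⟦⟧-++ []      L' m k = sym (ℤP.+-identityˡ _)
⟦⟧-++ (x ∷ L) L' m k =
  trans (cong (itemSeries x m k +ℤ_) (⟦⟧-++ L L' m k)) (sym (ℤP.+-assoc (itemSeries x m k) _ _))

⟦⟧-shift : ∀ a c L → ⟦ map (shiftItem a c) L ⟧ ≈ shift a c ⟦ L ⟧
⟦⟧-shift a c []                  = ≈-sym (shift-𝟘 a c)
⟦⟧-shift a c ((a' , c' , p) ∷ L) m k =
  trans (cong₂ _+ℤ_ (sym (shift-shift a c a' c' (W p) m k)) (⟦⟧-shift a c L m k))
        (sym (shift-⊕ a c (shift a' c' (W p)) ⟦ L ⟧ m k))

-- Which recurrence is applied to which W(p); at the leaves W(p) is kept.
data Expansion : Par → Set where
  keep : ∀ {p} → Expansion p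
  use₁ : ∀ {α β γ} → Expansion (suc α , β , γ) → Expansion (suc α , 2 + β , 3 + γ) →
         Expansion (α , β , γ)
  use₂ : ∀ {α β γ} → Expansion (α , 2 + β , γ) → Expansion (2 + α , 6 + β , 6 + γ) →
         Expansion (α , β , γ)
  use₃ : ∀ {α β γ} → Expansion (α , β , 3 + γ) → Expansion (3 + α , 6 + β , 9 + γ) →
         Expansion (α , β , γ)

terms : ∀ {p} → Expansion p → List Item
terms {p} keep                 = (0 , 0 , p) ∷ []
terms (use₁ {α} t u)           = terms t ++ map (shiftItem 1 α) (terms u)
terms (use₂ {β = β} t u)       = terms t ++ map (shiftItem 2 (2 + β)) (terms u)
terms (use₃ {γ = γ} t u)       = terms t ++ map (shiftItem 3 (3 + γ)) (terms u)

combine : ∀ {w w₁ w₂} a c L L' → w ≈ w₁ ⊕ shift a c w₂ → w₁ ≈ ⟦ L ⟧ → w₂ ≈ ⟦ L' ⟧ →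
          w ≈ ⟦ L ++ map (shiftItem a c) L' ⟧
combine {w} {w₁} {w₂} a c L L' rec w₁≈ w₂≈ = begin
  w                                  ≈⟨ rec ⟩
  w₁ ⊕ shift a c w₂                  ≈⟨ ⊕-cong w₁≈ (shift-cong a c w₂≈) ⟩
  ⟦ L ⟧ ⊕ shift a c ⟦ L' ⟧            ≈⟨ ⊕-cong {⟦ L ⟧} (λ _ _ → refl) (⟦⟧-shift a c L') ⟨
  ⟦ L ⟧ ⊕ ⟦ map (shiftItem a c) L' ⟧ ≈⟨ ⟦⟧-++ L (map (shiftItem a c) L') ⟨
  ⟦ L ++ map (shiftItem a c) L' ⟧    ∎
  where open ≈-Reasoning

expansion-sound : ∀ {p} (t : Expansion p) → W p ≈ ⟦ terms t ⟧
expansion-sound keep m k = sym (ℤP.+-identityʳ _)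
expansion-sound (use₁ {α} {β} {γ} t u) =
  combine 1 α (terms t) (terms u) (W-rec₁ α β γ) (expansion-sound t) (expansion-sound u)
expansion-sound (use₂ {α} {β} {γ} t u) =
  combine 2 (2 + β) (terms t) (terms u) (W-rec₂ α β γ) (expansion-sound t) (expansion-sound u)
expansion-sound (use₃ {α} {β} {γ} t u) =
  combine 3 (3 + γ) (terms t) (terms u) (W-rec₃ α β γ) (expansion-sound t) (expansion-sound u)

_≟ᴵ_ : DecidableEquality Item
_≟ᴵ_ = ≡-dec ℕ._≟_ (≡-dec ℕ._≟_ (≡-dec ℕ._≟_ (≡-dec ℕ._≟_ ℕ._≟_)))

remove : Item → List Item → Maybe (List Item)
remove x []      = nothing
remove x (y ∷ L) with x ≟ᴵ y
... | yes _ = just L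
... | no  _ = Maybe.map (y ∷_) (remove x L)

sameBag : List Item → List Item → Bool
sameBag []      []      = true
sameBag []      (_ ∷ _) = false
sameBag (x ∷ L) L'      with remove x L'
... | just L'' = sameBag L L''
... | nothing  = false

remove-sound : ∀ x L {L'} → remove x L ≡ just L' → ⟦ L ⟧ ≈ ⟦ x ∷ L' ⟧
remove-sound x (y ∷ L) eq with x ≟ᴵ y
remove-sound x (.x ∷ L) refl | yes refl = λ m k → refl
remove-sound x (y ∷ L)  eq   | no  _    with remove x L in removed
remove-sound x (y ∷ L)  refl | no  _    | just L'' = λ m k →
  trans (cong (itemSeries y m k +ℤ_) (remove-sound x L removed m k))
        (x∙yz≈y∙xz (itemSeries y m k) (itemSeries x m k) (⟦ L'' ⟧ m k))

sameBag-sound : ∀ L L' → sameBag L L' ≡ true → ⟦ L ⟧ ≈ ⟦ L' ⟧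
sameBag-sound []      []     _  = λ m k → refl
sameBag-sound (x ∷ L) L'     eq with remove x L' in removed
... | just L'' = λ m k →
  trans (cong (itemSeries x m k +ℤ_) (sameBag-sound L L'' eq m k))
        (sym (remove-sound x L' removed m k))

column : Fin 23 → Item
column j = proj₁ (lookup wExps j) , proj₂ (lookup wExps j) , params (block j) ⁺

column-sound : ∀ j → 𝒲 j ⊛ substXq3 (F j) ≈ itemSeries (column j)
column-sound j = begin
  mono a c ⊛ substXq3 (F j)
    ≈⟨ monomial-⊛ a c _ (mono-shift a c) ⟩
  shift a c (substXq3 (F j))
    ≈⟨ shift-cong a c (substXq3-cong (blockSeries-W (block j))) ⟩
  shift a c (substXq3 (W (params (block j))))
    ≈⟨ shift-cong a c (W-⁺ (params (block j))) ⟩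
  shift a c (W (params (block j) ⁺)) ∎
  where
  open ≈-Reasoning
  a = proj₁ (lookup wExps j)
  c = proj₂ (lookup wExps j)

keepIf : Bool → Item → List Item
keepIf true  x = x ∷ []
keepIf false x = []

select : ∀ n → (Fin n → Bool) → (Fin n → Item) → List Item
select zero    s t = []
select (suc n) s t = keepIf (s fzero) (t fzero) ++ select n (λ j → s (fsuc j)) (λ j → t (fsuc j))

select-sound : ∀ n s t (G : Fin n → Series) → (∀ j → G j ≈ itemSeries (t j)) →
               sumFin n (λ j → (if s j then + 1 else + 0) · G j) ≈ ⟦ select n s t ⟧
select-sound zero    s t G G≈ m k = refl
select-sound (suc n) s t G G≈ m k =
  trans (cong₂ _+ℤ_ (first (s fzero))
                    (select-sound n (λ j → s (fsuc j)) (λ j → t (fsuc j)) (λ j → G (fsuc j))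
                                  (λ j → G≈ (fsuc j)) m k))
        (sym (⟦⟧-++ (keepIf (s fzero) (t fzero)) _ m k))
  where
  first : ∀ b → (if b then + 1 else + 0) *ℤ G fzero m k ≡ ⟦ keepIf b (t fzero) ⟧ m k
  first true  = trans (ℤP.*-identityˡ _) (trans (G≈ fzero m k) (sym (ℤP.+-identityʳ _)))
  first false = ℤP.*-zeroˡ (G fzero m k)

rowItems : Block → List Item
rowItems b = select 23 (λ j → elemℕ (suc (toℕ j)) (columns b)) column

rhs-rowItems : ∀ i → rhs i ≈ ⟦ rowItems (block i) ⟧
rhs-rowItems i =
  select-sound 23 (λ j → elemℕ (suc (toℕ j)) (columns (block i))) column
               (λ j → 𝒲 j ⊛ substXq3 (F j)) column-sound

expand-3-6-10 : Expansion (3 , 6 , 10)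
expand-3-6-10 = use₁ keep (use₁ keep keep)

expand-3-4-10 : Expansion (3 , 4 , 10)
expand-3-4-10 = use₂ expand-3-6-10 keep

expand-3-4-7 : Expansion (3 , 4 , 7)
expand-3-4-7 = use₃ expand-3-4-10 keep

expand-2-4-7 : Expansion (2 , 4 , 7)
expand-2-4-7 = use₁ expand-3-4-7 expand-3-6-10

expand-2-2-7 : Expansion (2 , 2 , 7)
expand-2-2-7 = use₁ (use₂ expand-3-4-7 keep) expand-3-4-10

expand-2-2-4 : Expansion (2 , 2 , 4)
expand-2-2-4 = use₃ expand-2-2-7 keep

expand-1-0-1 : Expansion (1 , 0 , 1)
expand-1-0-1 = use₃ (use₁ (use₂ expand-2-2-4 keep) expand-2-2-7) keep

expansion : ∀ b → Expansion (params b)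
expansion b1 = expand-1-0-1
expansion b2 = expand-2-2-4
expansion b3 = expand-2-4-7
expansion b4 = expand-3-4-7

expansion-matches : ∀ b → sameBag (terms (expansion b)) (rowItems b) ≡ true
expansion-matches b1 = refl
expansion-matches b2 = refl
expansion-matches b3 = refl
expansion-matches b4 = refl

theorem4p4 : (i : Fin 23) (m k : ℕ) → F i m k ≡ rhs i m k
theorem4p4 i = begin
  F i
    ≈⟨ blockSeries-W (block i) ⟩
  W (params (block i))
    ≈⟨ expansion-sound (expansion (block i)) ⟩
  ⟦ terms (expansion (block i)) ⟧
    ≈⟨ sameBag-sound (terms (expansion (block i))) (rowItems (block i))
                     (expansion-matches (block i)) ⟩
  ⟦ rowItems (block i) ⟧
    ≈⟨ rhs-rowItems i ⟨
  rhs i ∎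
  where open ≈-Reasoning
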